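{- Let $d\geq1$ and let $t_0<t_1<t_2<\cdots$ be elements of $\mathbb{Z}^d$ with $t_0>0$, $t_n\geq 2t_{n-1}$ for all $n\geq1$, and such that for some $n\geq0$ all coordinates of $t_n$ are positive. Set $t_{ -1}=t_{ -2}=0$, $\mathcal{T}=\{t_0,t_1,\dots\}$, $\mathcal{W}=\mathcal{T}\cup\{0\}\cup(-\mathcal{T})$, and for $n\geq0$ let $\mathcal{I}_n=\mathcal{X}_{ -t_n,-t_{n-1}}$ and $\mathcal{J}_n=\mathcal{X}_{ -t_n,-t_{n-1}-t_{n-2}}$, where $\mathcal{X}_{P,Q}=\mathbb{Z}^d_{\geq P}\setminus\mathbb{Z}^d_{\geq Q}$. Then: (1) For all $n\geq0$, neither of the sets $\bigcup_{m\geq n+2}\mathcal{J}_m+\mathcal{W}$ and $\mathcal{J}_{n+1}+(\mathcal{W}\setminus\{t_n\})$ contains a point of $\mathcal{I}_n$. (2) For any $n\geq1$, $$\big(\mathcal{J}_0\cup\cdots\cup\mathcal{J}_{n-1}\cup(\mathcal{J}_n\cap\mathbb{Z}^d_{\geq -2t_{n-1}})\big)+\mathcal{W}\subseteq(\mathbb{Z}^d\setminus\mathbb{Z}^d_{\geq -t_n})\cup\mathbb{Z}^d_{\geq -3t_{n-1}}.$$ (3) If $t_n>3t_{n-1}$ for all $n\geq1$, then for all $n\geq0$ the set $\bigcup_{m\geq n+1}\big(-(\mathcal{J}_m\cap\mathbb{Z}^d_{\geq -2t_{m-1}})\big)+\mathcal{W}$ contains no point of $\mathcal{I}_n$. (4)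 If $t_n\geq 3t_{n-1}$ for all $n\geq1$, then for any $n\geq1$, $$\big(-(\mathcal{J}_1\cup\cdots\cup\mathcal{J}_n)\big)+(\mathcal{W}\setminus\{ -t_n\})\subseteq\mathbb{Z}^d_{\leq -2t_n}\cup(\mathbb{Z}^d\setminus\mathbb{Z}^d_{\leq -t_{n-1}}).$$
   Context: All inequalities between elements of $\mathbb{Z}^d$ refer to the lexicographic order; $kt$ is the scalar multiple of $t$. For $x\in\mathbb{Z}^d$, $\mathbb{Z}^d_{\geq x}=\{n: n\geq x\}$ and $\mathbb{Z}^d_{\leq x}=\{n: n\leq x\}$. For sets $A,B$, $A+B=\{a+b: a\in A,b\in B\}$ and $-A=\{ -a:a\in A\}$. -}

module Defs where

open import Data.Nat using (ℕ; zero; suc)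
open import Data.Integer as ℤ using (ℤ; +_)
open import Data.Vec using (Vec; []; _∷_; zipWith; map; replicate)
open import Data.Product using (Σ; ∃; _×_; _,_)
open import Data.Sum using (_⊎_)
open import Data.Empty using (⊥)
open import Relation.Binary.PropositionalEquality using (_≡_)
open import Relation.Nullary using (¬_)

Pt : ℕ → Set
Pt d = Vec ℤ d

_⊕_ : ∀ {d} → Pt d → Pt d → Pt d
_⊕_ = zipWith ℤ._+_

⊖_ : ∀ {d} → Pt d → Pt d
⊖ v = map (λ z → ℤ.- z) v

𝟘 : ∀ {d} → Pt d
𝟘 {d} = replicate d (+ 0)

_·_ : ∀ {d} → ℤ → Pt d → Pt d
k · v = map (k ℤ.*_) v

_<ₗ_ : ∀ {d} → Pt d → Pt d → Set
[] <ₗ [] = ⊥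
(x ∷ xs) <ₗ (y ∷ ys) = (x ℤ.< y) ⊎ (x ≡ y × xs <ₗ ys)

_≤ₗ_ : ∀ {d} → Pt d → Pt d → Set
x ≤ₗ y = x <ₗ y ⊎ x ≡ y

AllPos : ∀ {d} → Pt d → Set
AllPos [] = Data.Unit.⊤ where import Data.Unit
AllPos (x ∷ xs) = (+ 0 ℤ.< x) × AllPos xs

PSet : ℕ → Set₁
PSet d = Pt d → Set

_⊞_ : ∀ {d} → PSet d → PSet d → PSet d
(A ⊞ B) x = Σ _ λ a → Σ _ λ b → A a × B b × x ≡ a ⊕ b

neg : ∀ {d} → PSet d → PSet d
neg A x = A (⊖ x)

X : ∀ {d} → Pt d → Pt d → PSet d
X P Q x = P ≤ₗ x × ¬ (Q ≤ₗ x)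

-- t_{n-1} and t_{n-2} with convention t_{-1} = t_{-2} = 0
prev1 : ∀ {d} → (ℕ → Pt d) → ℕ → Pt d
prev1 t zero = 𝟘
prev1 t (suc n) = t n

prev2 : ∀ {d} → (ℕ → Pt d) → ℕ → Pt d
prev2 t zero = 𝟘
prev2 t (suc zero) = 𝟘
prev2 t (suc (suc n)) = t n

W : ∀ {d} → (ℕ → Pt d) → PSet d
W t w = (∃ λ k → w ≡ t k) ⊎ (w ≡ 𝟘) ⊎ (∃ λ k → w ≡ ⊖ t k)

Wminus : ∀ {d} → (ℕ → Pt d) → Pt d → PSet d
Wminus t p w = W t w × ¬ (w ≡ p)

I : ∀ {d} → (ℕ → Pt d) → ℕ → PSet d
I t n = X (⊖ t n) (⊖ prev1 t n)

J : ∀ {d} → (ℕ → Pt d) → ℕ → PSet d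
J t n = X (⊖ t n) ((⊖ prev1 t n) ⊕ (⊖ prev2 t n))

{-# OPTIONS --safe #-}
module Submission where

-- The lexicographic order makes ℤ^d a totally ordered abelian group, and the
-- whole argument is arithmetic in that group using only that t is positive and
-- increasing (plus 3tₙ₋₁ < tₙ, resp. ≤, in (3) and (4)); the hypotheses d ≥ 1,
-- tₙ ≥ 2tₙ₋₁ and "some tₙ has positive coordinates" are not needed.
-- Relative to an index j, every w ∈ 𝒲 is either ±tₖ with k ≥ j or lies in
-- [-tⱼ₋₁, tⱼ₋₁]. A point a ∈ 𝒥ₘ satisfies -tₘ ≤ a < -tₘ₋₁ - tₘ₋₂, so a + tₖ ≥ 0
-- for k ≥ m, while a + w < -tₘ₋₂ for w ≤ tₘ₋₁; either way a + w misses
-- ℐₙ = [-tₙ, -tₙ₋₁). Parts (2)–(4) are the same case split applied to -tₖ,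
-- where the growth condition pushes 2tₘ - tₘ₊₁ below -tₘ.

open import Defs
open import Algebra.Bundles using (AbelianGroup)
open import Algebra.Structures using (IsAbelianGroup)
open import Data.Integer as ℤ using (ℤ; +_)
import Data.Integer.Properties as ℤP
open import Data.Nat using (ℕ; zero; suc; _≤_; _<_; _+_; z≤n; s≤s; _≤′_; ≤′-refl; ≤′-step)
open import Data.Nat.Properties using (≤⇒≤′; ≤-<-connex; m≤n⇒m<n∨m≡n; +-comm)
open import Data.Product using (∃; _×_; _,_; proj₁; proj₂)
open import Data.Sum using (_⊎_; inj₁; inj₂)
open import Data.Vec using ([]; _∷_)
open import Data.Vec.Properties
  using (zipWith-assoc; zipWith-comm; zipWith-identityˡ; zipWith-identityʳ; zipWith-inverseˡ; zipWith-inverseʳ)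
open import Function using (_∘_)
open import Level using (0ℓ)
open import Relation.Binary.Bundles using (StrictPartialOrder)
open import Relation.Binary.Definitions using (Transitive; Irreflexive; tri<; tri≈; tri>)
open import Relation.Binary.PropositionalEquality using (_≡_; refl; sym; trans; cong; cong₂; subst; subst₂; isEquivalence; resp₂)
open import Relation.Binary.PropositionalEquality.Algebra using (isMagma)
open import Relation.Binary.Structures using (IsStrictPartialOrder)
open import Relation.Nullary using (¬_; contradiction)

⊕-⊖-𝟘-isAbelianGroup : ∀ {d} → IsAbelianGroup _≡_ (_⊕_ {d}) 𝟘 ⊖_
⊕-⊖-𝟘-isAbelianGroup = record
  { isGroup = record
    { isMonoid = record
      { isSemigroup = record
        { isMagma = isMagma _⊕_
        ; assoc   = zipWith-assoc ℤP.+-assoc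
        }
      ; identity = zipWith-identityˡ ℤP.+-identityˡ , zipWith-identityʳ ℤP.+-identityʳ
      }
    ; inverse = zipWith-inverseˡ ℤP.+-inverseˡ , zipWith-inverseʳ ℤP.+-inverseʳ
    ; ⁻¹-cong = cong ⊖_
    }
  ; comm = zipWith-comm ℤP.+-comm
  }

⊕-⊖-𝟘-abelianGroup : ℕ → AbelianGroup 0ℓ 0ℓ
⊕-⊖-𝟘-abelianGroup d = record { isAbelianGroup = ⊕-⊖-𝟘-isAbelianGroup {d} }

·-identityˡ : ∀ {d} (v : Pt d) → (+ 1) · v ≡ v
·-identityˡ []       = refl
·-identityˡ (x ∷ xs) = cong₂ _∷_ (ℤP.*-identityˡ x) (·-identityˡ xs)

·-distribʳ-+ : ∀ {d} (k l : ℤ) (v : Pt d) → (k ℤ.+ l) · v ≡ (k · v) ⊕ (l · v)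
·-distribʳ-+ k l []       = refl
·-distribʳ-+ k l (x ∷ xs) = cong₂ _∷_ (ℤP.*-distribʳ-+ x k l) (·-distribʳ-+ k l xs)

<ₗ-irrefl : ∀ {d} → Irreflexive _≡_ (_<ₗ_ {d})
<ₗ-irrefl {x = []}    refl ()
<ₗ-irrefl {x = _ ∷ _} refl (inj₁ x<x)     = ℤP.<-irrefl refl x<x
<ₗ-irrefl {x = _ ∷ _} refl (inj₂ (_ , p)) = <ₗ-irrefl refl p

<ₗ-trans : ∀ {d} → Transitive (_<ₗ_ {d})
<ₗ-trans {i = []}    {[]}    {[]}    ()
<ₗ-trans {i = _ ∷ _} {_ ∷ _} {_ ∷ _} (inj₁ p)          (inj₁ q)          = inj₁ (ℤP.<-trans p q)
<ₗ-trans {i = _ ∷ _} {_ ∷ _} {_ ∷ _} (inj₁ p)          (inj₂ (refl , _)) = inj₁ p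
<ₗ-trans {i = _ ∷ _} {_ ∷ _} {_ ∷ _} (inj₂ (refl , _)) (inj₁ q)          = inj₁ q
<ₗ-trans {i = _ ∷ _} {_ ∷ _} {_ ∷ _} (inj₂ (refl , p)) (inj₂ (refl , q)) = inj₂ (refl , <ₗ-trans p q)

<ₗ-compare : ∀ {d} (x y : Pt d) → x <ₗ y ⊎ x ≡ y ⊎ y <ₗ x
<ₗ-compare []       []       = inj₂ (inj₁ refl)
<ₗ-compare (x ∷ xs) (y ∷ ys) with ℤP.<-cmp x y
... | tri< x<y _ _ = inj₁ (inj₁ x<y)
... | tri> _ _ y<x = inj₂ (inj₂ (inj₁ y<x))
... | tri≈ _ refl _ with <ₗ-compare xs ys
...   | inj₁ p           = inj₁ (inj₂ (refl , p))
...   | inj₂ (inj₁ refl) = inj₂ (inj₁ refl)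
...   | inj₂ (inj₂ p)    = inj₂ (inj₂ (inj₂ (refl , p)))

<ₗ-isStrictPartialOrder : ∀ {d} → IsStrictPartialOrder _≡_ (_<ₗ_ {d})
<ₗ-isStrictPartialOrder = record
  { isEquivalence = isEquivalence
  ; irrefl        = <ₗ-irrefl
  ; trans         = <ₗ-trans
  ; <-resp-≈      = resp₂ _<ₗ_
  }

<ₗ-strictPartialOrder : ℕ → StrictPartialOrder 0ℓ 0ℓ 0ℓ
<ₗ-strictPartialOrder d = record { isStrictPartialOrder = <ₗ-isStrictPartialOrder {d} }

⊕-monoˡ-< : ∀ {d} {x y : Pt d} (z : Pt d) → x <ₗ y → (x ⊕ z) <ₗ (y ⊕ z)
⊕-monoˡ-< {x = []}    {[]}    []       ()
⊕-monoˡ-< {x = _ ∷ _} {_ ∷ _} (z ∷ _)  (inj₁ p)          = inj₁ (ℤP.+-monoˡ-< z p)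
⊕-monoˡ-< {x = _ ∷ _} {_ ∷ _} (_ ∷ zs) (inj₂ (refl , p)) = inj₂ (refl , ⊕-monoˡ-< zs p)

⊖-mono-< : ∀ {d} {x y : Pt d} → x <ₗ y → (⊖ y) <ₗ (⊖ x)
⊖-mono-< {x = []}    {[]}    ()
⊖-mono-< {x = _ ∷ _} {_ ∷ _} (inj₁ p)          = inj₁ (ℤP.neg-mono-< p)
⊖-mono-< {x = _ ∷ _} {_ ∷ _} (inj₂ (refl , p)) = inj₂ (refl , ⊖-mono-< p)

module _ {d : ℕ} where

  open AbelianGroup (⊕-⊖-𝟘-abelianGroup d)
    using (comm; identityˡ; identityʳ; inverseˡ; inverseʳ)
  open import Algebra.Properties.AbelianGroup (⊕-⊖-𝟘-abelianGroup d)
    using (⁻¹-involutive; ⁻¹-∙-comm; ε⁻¹≈ε; xyx⁻¹≈y; //-rightDividesʳ)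
  open import Relation.Binary.Construct.StrictToNonStrict _≡_ (_<ₗ_ {d})
    using (<⇒≤)
  open import Relation.Binary.Reasoning.StrictPartialOrder (<ₗ-strictPartialOrder d)

  private
    variable
      u v w x y z : Pt d

  <ₗ⇒≱ₗ : x <ₗ y → ¬ (y ≤ₗ x)
  <ₗ⇒≱ₗ x<y y≤x = <ₗ-irrefl refl (begin-strict _ <⟨ x<y ⟩ _ ≤⟨ y≤x ⟩ _ ∎)

  ≰ₗ⇒>ₗ : ¬ (x ≤ₗ y) → y <ₗ x
  ≰ₗ⇒>ₗ {x} {y} x≰y with <ₗ-compare x y
  ... | inj₁ x<y        = contradiction (inj₁ x<y) x≰y
  ... | inj₂ (inj₁ x≡y) = contradiction (inj₂ x≡y) x≰y
  ... | inj₂ (inj₂ y<x) = y<x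

  ⊕-monoʳ-< : x <ₗ y → (z ⊕ x) <ₗ (z ⊕ y)
  ⊕-monoʳ-< {x} {y} {z} x<y = begin-strict
    z ⊕ x  ≡⟨ comm z x ⟩
    x ⊕ z  <⟨ ⊕-monoˡ-< z x<y ⟩
    y ⊕ z  ≡⟨ comm y z ⟩
    z ⊕ y  ∎

  ⊕-monoˡ-≤ : ∀ z → x ≤ₗ y → (x ⊕ z) ≤ₗ (y ⊕ z)
  ⊕-monoˡ-≤ z (inj₁ x<y) = inj₁ (⊕-monoˡ-< z x<y)
  ⊕-monoˡ-≤ z (inj₂ refl) = inj₂ refl

  ⊕-monoʳ-≤ : x ≤ₗ y → (z ⊕ x) ≤ₗ (z ⊕ y)
  ⊕-monoʳ-≤ (inj₁ x<y) = inj₁ (⊕-monoʳ-< x<y)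
  ⊕-monoʳ-≤ (inj₂ refl) = inj₂ refl

  ⊕-mono-≤ : x ≤ₗ y → u ≤ₗ v → (x ⊕ u) ≤ₗ (y ⊕ v)
  ⊕-mono-≤ {x} {y} {u} {v} x≤y u≤v = begin
    x ⊕ u  ≤⟨ ⊕-monoˡ-≤ u x≤y ⟩
    y ⊕ u  ≤⟨ ⊕-monoʳ-≤ u≤v ⟩
    y ⊕ v  ∎

  ⊕-mono-<-≤ : x <ₗ y → u ≤ₗ v → (x ⊕ u) <ₗ (y ⊕ v)
  ⊕-mono-<-≤ {x} {y} {u} {v} x<y u≤v = begin-strict
    x ⊕ u  <⟨ ⊕-monoˡ-< u x<y ⟩
    y ⊕ u  ≤⟨ ⊕-monoʳ-≤ u≤v ⟩
    y ⊕ v  ∎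

  x≤x⊕y : 𝟘 ≤ₗ y → x ≤ₗ (x ⊕ y)
  x≤x⊕y {y} {x} 𝟘≤y = begin
    x      ≡⟨ identityʳ x ⟨
    x ⊕ 𝟘  ≤⟨ ⊕-monoʳ-≤ 𝟘≤y ⟩
    x ⊕ y  ∎

  x⊕y≤x : y ≤ₗ 𝟘 → (x ⊕ y) ≤ₗ x
  x⊕y≤x {y} {x} y≤𝟘 = begin
    x ⊕ y  ≤⟨ ⊕-monoʳ-≤ y≤𝟘 ⟩
    x ⊕ 𝟘  ≡⟨ identityʳ x ⟩
    x      ∎

  ⊖-mono-≤ : x ≤ₗ y → (⊖ y) ≤ₗ (⊖ x)
  ⊖-mono-≤ (inj₁ x<y) = inj₁ (⊖-mono-< x<y)
  ⊖-mono-≤ (inj₂ refl) = inj₂ refl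

  ⊖-cancel-< : (⊖ x) <ₗ (⊖ y) → y <ₗ x
  ⊖-cancel-< {x} {y} ⊖x<⊖y = subst₂ _<ₗ_ (⁻¹-involutive y) (⁻¹-involutive x) (⊖-mono-< ⊖x<⊖y)

  ⊖-cancel-≤ : (⊖ x) ≤ₗ (⊖ y) → y ≤ₗ x
  ⊖-cancel-≤ {x} {y} ⊖x≤⊖y = subst₂ _≤ₗ_ (⁻¹-involutive y) (⁻¹-involutive x) (⊖-mono-≤ ⊖x≤⊖y)

  ⊖-nonpos : 𝟘 ≤ₗ x → (⊖ x) ≤ₗ 𝟘
  ⊖-nonpos {x} 𝟘≤x = subst ((⊖ x) ≤ₗ_) ε⁻¹≈ε (⊖-mono-≤ 𝟘≤x)

  x<⊖u⊕⊖v∧w≤u⇒x⊕w<⊖v : x <ₗ ((⊖ u) ⊕ (⊖ v)) → w ≤ₗ u → (x ⊕ w) <ₗ (⊖ v)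
  x<⊖u⊕⊖v∧w≤u⇒x⊕w<⊖v {x} {u} {v} {w} x<⊖u⊕⊖v w≤u = begin-strict
    x ⊕ w                      <⟨ ⊕-mono-<-≤ x<⊖u⊕⊖v w≤u ⟩
    ((⊖ u) ⊕ (⊖ v)) ⊕ u        ≡⟨ cong (((⊖ u) ⊕ (⊖ v)) ⊕_) (⁻¹-involutive u) ⟨
    ((⊖ u) ⊕ (⊖ v)) ⊕ (⊖ ⊖ u)  ≡⟨ xyx⁻¹≈y (⊖ u) (⊖ v) ⟩
    ⊖ v                        ∎

  x⊕y≤z⇒x⊕⊖z≤⊖y : (x ⊕ y) ≤ₗ z → (x ⊕ (⊖ z)) ≤ₗ (⊖ y)
  x⊕y≤z⇒x⊕⊖z≤⊖y {x} {y} {z} x⊕y≤z = begin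
    x ⊕ (⊖ z)                  ≡⟨ cong (_⊕ (⊖ z)) (//-rightDividesʳ y x) ⟨
    ((x ⊕ y) ⊕ (⊖ y)) ⊕ (⊖ z)  ≤⟨ ⊕-monoˡ-≤ (⊖ z) (⊕-monoˡ-≤ (⊖ y) x⊕y≤z) ⟩
    (z ⊕ (⊖ y)) ⊕ (⊖ z)        ≡⟨ xyx⁻¹≈y z (⊖ y) ⟩
    ⊖ y                        ∎

  x⊕y<z⇒x⊕⊖z<⊖y : (x ⊕ y) <ₗ z → (x ⊕ (⊖ z)) <ₗ (⊖ y)
  x⊕y<z⇒x⊕⊖z<⊖y {x} {y} {z} x⊕y<z = begin-strict
    x ⊕ (⊖ z)                  ≡⟨ cong (_⊕ (⊖ z)) (//-rightDividesʳ y x) ⟨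
    ((x ⊕ y) ⊕ (⊖ y)) ⊕ (⊖ z)  <⟨ ⊕-monoˡ-< (⊖ z) (⊕-monoˡ-< (⊖ y) x⊕y<z) ⟩
    (z ⊕ (⊖ y)) ⊕ (⊖ z)        ≡⟨ xyx⁻¹≈y z (⊖ y) ⟩
    ⊖ y                        ∎

  2·x≡x⊕x : (x : Pt d) → (+ 2) · x ≡ x ⊕ x
  2·x≡x⊕x x = trans (·-distribʳ-+ (+ 1) (+ 1) x) (cong₂ _⊕_ (·-identityˡ x) (·-identityˡ x))

  3·x≡2·x⊕x : (x : Pt d) → (+ 3) · x ≡ ((+ 2) · x) ⊕ x
  3·x≡2·x⊕x x = trans (·-distribʳ-+ (+ 2) (+ 1) x) (cong (((+ 2) · x) ⊕_) (·-identityˡ x))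

  module PositiveIncreasing
    (t : ℕ → Pt d) (t-inc : ∀ n → t n <ₗ t (suc n)) (t₀-pos : 𝟘 <ₗ t 0) where

    private
      variable
        a : Pt d
        j k m n : ℕ

    t-pos : ∀ k → 𝟘 <ₗ t k
    t-pos zero    = t₀-pos
    t-pos (suc k) = <ₗ-trans (t-pos k) (t-inc k)

    t-mono : k ≤ j → t k ≤ₗ t j
    t-mono = t-mono′ ∘ ≤⇒≤′
      where
      t-mono′ : k ≤′ j → t k ≤ₗ t j
      t-mono′ ≤′-refl                = inj₂ refl
      t-mono′ (≤′-step {n} k≤′n) = begin
        t _        ≤⟨ t-mono′ k≤′n ⟩
        t n        <⟨ t-inc n ⟩
        t (suc n)  ∎

    prev1-nonneg : ∀ n → 𝟘 ≤ₗ prev1 t n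
    prev1-nonneg zero    = inj₂ refl
    prev1-nonneg (suc n) = <⇒≤ (t-pos n)

    prev2-nonneg : ∀ n → 𝟘 ≤ₗ prev2 t n
    prev2-nonneg zero          = inj₂ refl
    prev2-nonneg (suc zero)    = inj₂ refl
    prev2-nonneg (suc (suc n)) = <⇒≤ (t-pos n)

    prev2-suc : ∀ n → prev2 t (suc n) ≡ prev1 t n
    prev2-suc zero    = refl
    prev2-suc (suc n) = refl

    t≤prev1 : k < j → t k ≤ₗ prev1 t j
    t≤prev1 (s≤s k≤j) = t-mono k≤j

    W-split : ∀ j → W t w → (∃ λ k → j ≤ k × w ≡ t k) ⊎ w ≤ₗ prev1 t j
    W-split j (inj₁ (k , refl)) with ≤-<-connex j k
    ... | inj₁ j≤k = inj₁ (k , j≤k , refl)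
    ... | inj₂ k<j = inj₂ (t≤prev1 k<j)
    W-split j (inj₂ (inj₁ refl)) = inj₂ (prev1-nonneg j)
    W-split j (inj₂ (inj₂ (k , refl))) = inj₂ (begin
      ⊖ t k      ≤⟨ ⊖-nonpos (<⇒≤ (t-pos k)) ⟩
      𝟘          ≤⟨ prev1-nonneg j ⟩
      prev1 t j  ∎)

    W-split-⊖ : ∀ j → W t w → (∃ λ k → j ≤ k × w ≡ ⊖ t k) ⊎ (⊖ prev1 t j) ≤ₗ w
    W-split-⊖ j (inj₁ (k , refl)) = inj₂ (begin
      ⊖ prev1 t j  ≤⟨ ⊖-nonpos (prev1-nonneg j) ⟩
      𝟘            <⟨ t-pos k ⟩
      t k          ∎)
    W-split-⊖ j (inj₂ (inj₁ refl)) = inj₂ (⊖-nonpos (prev1-nonneg j))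
    W-split-⊖ j (inj₂ (inj₂ (k , refl))) with ≤-<-connex j k
    ... | inj₁ j≤k = inj₁ (k , j≤k , refl)
    ... | inj₂ k<j = inj₂ (⊖-mono-≤ (t≤prev1 k<j))

    J⇒<⊖prev1⊕⊖prev2 : J t m a → a <ₗ ((⊖ prev1 t m) ⊕ (⊖ prev2 t m))
    J⇒<⊖prev1⊕⊖prev2 = ≰ₗ⇒>ₗ ∘ proj₂

    J⇒<⊖prev1 : J t m a → a <ₗ (⊖ prev1 t m)
    J⇒<⊖prev1 {m} {a} a∈J = begin-strict
      a                              <⟨ J⇒<⊖prev1⊕⊖prev2 a∈J ⟩
      (⊖ prev1 t m) ⊕ (⊖ prev2 t m)  ≤⟨ x⊕y≤x (⊖-nonpos (prev2-nonneg m)) ⟩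
      ⊖ prev1 t m                    ∎

    J⇒<𝟘 : J t m a → a <ₗ 𝟘
    J⇒<𝟘 {m} {a} a∈J = begin-strict
      a            <⟨ J⇒<⊖prev1 a∈J ⟩
      ⊖ prev1 t m  ≤⟨ ⊖-nonpos (prev1-nonneg m) ⟩
      𝟘            ∎

    J⊕≥t⇒≥𝟘 : J t m a → t m ≤ₗ w → 𝟘 ≤ₗ (a ⊕ w)
    J⊕≥t⇒≥𝟘 {m} {a} {w} (⊖t≤a , _) t≤w = begin
      𝟘              ≡⟨ inverseˡ (t m) ⟨
      (⊖ t m) ⊕ t m  ≤⟨ ⊕-mono-≤ ⊖t≤a t≤w ⟩
      a ⊕ w          ∎

    J⊕≤prev1⇒<⊖prev2 : J t m a → w ≤ₗ prev1 t m → (a ⊕ w) <ₗ (⊖ prev2 t m)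
    J⊕≤prev1⇒<⊖prev2 a∈J = x<⊖u⊕⊖v∧w≤u⇒x⊕w<⊖v (J⇒<⊖prev1⊕⊖prev2 a∈J)

    J⊕≤prev2⇒<⊖prev1 : J t m a → w ≤ₗ prev2 t m → (a ⊕ w) <ₗ (⊖ prev1 t m)
    J⊕≤prev2⇒<⊖prev1 {m} a∈J =
      x<⊖u⊕⊖v∧w≤u⇒x⊕w<⊖v (subst (_ <ₗ_) (comm (⊖ prev1 t m) (⊖ prev2 t m)) (J⇒<⊖prev1⊕⊖prev2 a∈J))

    I⇒≮⊖t : I t n x → ¬ (x <ₗ (⊖ t n))
    I⇒≮⊖t (⊖t≤x , _) x<⊖t = <ₗ⇒≱ₗ x<⊖t ⊖t≤x

    I⇒<𝟘 : I t n x → x <ₗ 𝟘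
    I⇒<𝟘 {n} {x} (_ , ⊖prev1≰x) = begin-strict
      x            <⟨ ≰ₗ⇒>ₗ ⊖prev1≰x ⟩
      ⊖ prev1 t n  ≤⟨ ⊖-nonpos (prev1-nonneg n) ⟩
      𝟘            ∎

    I⇒∉J⊞W : suc (suc n) ≤ m → I t n x → ¬ (J t m ⊞ W t) x
    I⇒∉J⊞W {n} {suc (suc m)} (s≤s (s≤s n≤m)) x∈I (a , w , a∈J , w∈W , refl)
      with W-split (suc (suc m)) w∈W
    ... | inj₁ (k , m+2≤k , refl) = <ₗ⇒≱ₗ (I⇒<𝟘 x∈I) (J⊕≥t⇒≥𝟘 a∈J (t-mono m+2≤k))
    ... | inj₂ w≤t = I⇒≮⊖t x∈I (begin-strict
      a ⊕ w  <⟨ J⊕≤prev1⇒<⊖prev2 a∈J w≤t ⟩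
      ⊖ t m  ≤⟨ ⊖-mono-≤ (t-mono n≤m) ⟩
      ⊖ t n  ∎)

    I⇒∉J⊞W∖t : I t n x → ¬ (J t (suc n) ⊞ Wminus t (t n)) x
    I⇒∉J⊞W∖t {n} x∈I (a , w , a∈J , (w∈W , w≢t) , refl) with W-split n w∈W
    ... | inj₂ w≤prev1 = I⇒≮⊖t x∈I (J⊕≤prev2⇒<⊖prev1 a∈J (subst (w ≤ₗ_) (sym (prev2-suc n)) w≤prev1))
    ... | inj₁ (k , n≤k , refl) with m≤n⇒m<n∨m≡n n≤k
    ...   | inj₂ refl = w≢t refl
    ...   | inj₁ n<k  = <ₗ⇒≱ₗ (I⇒<𝟘 x∈I) (J⊕≥t⇒≥𝟘 a∈J (t-mono n<k))

    ⊕W-bound : (⊖ ((+ 2) · t n)) ≤ₗ a → a <ₗ 𝟘 → W t w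
             → ¬ ((⊖ t (suc n)) ≤ₗ (a ⊕ w)) ⊎ (⊖ ((+ 3) · t n)) ≤ₗ (a ⊕ w)
    ⊕W-bound {n} {a} {w} ⊖2t≤a a<𝟘 w∈W with W-split-⊖ (suc n) w∈W
    ... | inj₁ (k , n<k , refl) = inj₁ (<ₗ⇒≱ₗ (begin-strict
      a ⊕ (⊖ t k)  <⟨ ⊕-monoˡ-< (⊖ t k) a<𝟘 ⟩
      𝟘 ⊕ (⊖ t k)  ≡⟨ identityˡ (⊖ t k) ⟩
      ⊖ t k        ≤⟨ ⊖-mono-≤ (t-mono n<k) ⟩
      ⊖ t (suc n)  ∎))
    ... | inj₂ ⊖t≤w = inj₂ (begin
      ⊖ ((+ 3) · t n)              ≡⟨ cong ⊖_ (3·x≡2·x⊕x (t n)) ⟩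
      ⊖ (((+ 2) · t n) ⊕ t n)      ≡⟨ ⁻¹-∙-comm ((+ 2) · t n) (t n) ⟨
      (⊖ ((+ 2) · t n)) ⊕ (⊖ t n)  ≤⟨ ⊕-mono-≤ ⊖2t≤a ⊖t≤w ⟩
      a ⊕ w                        ∎)

    J⊞W-bound : ∀ n → 1 ≤ n → ∀ x
      → ((λ a → (∃ λ m → (m < n) × J t m a) ⊎ (J t n a × (⊖ ((+ 2) · prev1 t n)) ≤ₗ a)) ⊞ W t) x
      → ¬ ((⊖ t n) ≤ₗ x) ⊎ (⊖ ((+ 3) · prev1 t n)) ≤ₗ x
    J⊞W-bound (suc n) _ x (a , w , inj₁ (m , s≤s m≤n , a∈J) , w∈W , refl) =
      ⊕W-bound ⊖2t≤a (J⇒<𝟘 a∈J) w∈W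
      where
      ⊖2t≤a : (⊖ ((+ 2) · t n)) ≤ₗ a
      ⊖2t≤a = begin
        ⊖ ((+ 2) · t n)  ≡⟨ cong ⊖_ (2·x≡x⊕x (t n)) ⟩
        ⊖ (t n ⊕ t n)    ≤⟨ ⊖-mono-≤ (x≤x⊕y (<⇒≤ (t-pos n))) ⟩
        ⊖ t n            ≤⟨ ⊖-mono-≤ (t-mono m≤n) ⟩
        ⊖ t m            ≤⟨ proj₁ a∈J ⟩
        a                ∎
    J⊞W-bound (suc n) _ x (a , w , inj₂ (a∈J , ⊖2t≤a) , w∈W , refl) =
      ⊕W-bound ⊖2t≤a (J⇒<𝟘 a∈J) w∈W

    I⇒∉⊖J⊞W : (∀ n → ((+ 3) · t n) <ₗ t (suc n))
      → ∀ n x → I t n x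
      → ¬ (∃ λ m → (suc n ≤ m)
            × ((neg (λ a → J t m a × (⊖ ((+ 2) · prev1 t m)) ≤ₗ a)) ⊞ W t) x)
    I⇒∉⊖J⊞W 3t<t n x x∈I (suc m , s≤s n≤m , a , w , (⊖a∈J , ⊖2t≤⊖a) , w∈W , refl)
      with W-split-⊖ (suc m) w∈W
    ... | inj₁ (k , m<k , refl) = I⇒≮⊖t x∈I (begin-strict
      a ⊕ (⊖ t k)                    ≤⟨ ⊕-mono-≤ (⊖-cancel-≤ ⊖2t≤⊖a) (⊖-mono-≤ (t-mono m<k)) ⟩
      ((+ 2) · t m) ⊕ (⊖ t (suc m))  <⟨ x⊕y<z⇒x⊕⊖z<⊖y (subst (_<ₗ t (suc m)) (3·x≡2·x⊕x (t m)) (3t<t m)) ⟩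
      ⊖ t m                          ≤⟨ ⊖-mono-≤ (t-mono n≤m) ⟩
      ⊖ t n                          ∎)
    ... | inj₂ ⊖t≤w = <ₗ⇒≱ₗ (I⇒<𝟘 x∈I) (<⇒≤ (begin-strict
      𝟘              ≡⟨ inverseʳ (t m) ⟨
      t m ⊕ (⊖ t m)  <⟨ ⊕-mono-<-≤ (⊖-cancel-< (J⇒<⊖prev1 ⊖a∈J)) ⊖t≤w ⟩
      a ⊕ w          ∎))

    ⊖J⊞W∖⊖t-bound : (∀ n → ((+ 3) · t n) ≤ₗ t (suc n))
      → ∀ n → 1 ≤ n → ∀ x
      → ((neg (λ a → ∃ λ m → (1 ≤ m) × (m ≤ n) × J t m a)) ⊞ Wminus t (⊖ t n)) x
      → x ≤ₗ (⊖ ((+ 2) · t n)) ⊎ ¬ (x ≤ₗ (⊖ prev1 t n))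
    ⊖J⊞W∖⊖t-bound 3t≤t n@(suc n′) _ x (a , w , (suc m , _ , m≤n , ⊖a∈J) , (w∈W , w≢⊖t) , refl)
      with W-split-⊖ n w∈W
    ... | inj₂ ⊖t≤w = inj₂ (<ₗ⇒≱ₗ (begin-strict
      ⊖ t n′        ≡⟨ identityˡ (⊖ t n′) ⟨
      𝟘 ⊕ (⊖ t n′)  <⟨ ⊕-mono-<-≤ 𝟘<a ⊖t≤w ⟩
      a ⊕ w         ∎))
      where
      𝟘<a : 𝟘 <ₗ a
      𝟘<a = begin-strict
        𝟘    <⟨ t-pos m ⟩
        t m  <⟨ ⊖-cancel-< (J⇒<⊖prev1 ⊖a∈J) ⟩
        a    ∎
    ... | inj₁ (k , n≤k , refl) with m≤n⇒m<n∨m≡n n≤k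
    ...   | inj₂ refl = contradiction refl w≢⊖t
    ...   | inj₁ n<k  = inj₁ (begin
      a ⊕ (⊖ t k)          ≤⟨ ⊕-mono-≤ a≤t (⊖-mono-≤ (t-mono n<k)) ⟩
      t n ⊕ (⊖ t (suc n))  ≤⟨ x⊕y≤z⇒x⊕⊖z≤⊖y t⊕2t≤t ⟩
      ⊖ ((+ 2) · t n)      ∎)
      where
      a≤t : a ≤ₗ t n
      a≤t = begin
        a          ≤⟨ ⊖-cancel-≤ (proj₁ ⊖a∈J) ⟩
        t (suc m)  ≤⟨ t-mono m≤n ⟩
        t n        ∎
      t⊕2t≤t : (t n ⊕ ((+ 2) · t n)) ≤ₗ t (suc n)
      t⊕2t≤t = subst (_≤ₗ t (suc n)) (trans (3·x≡2·x⊕x (t n)) (comm _ _)) (3t≤t n)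

proposition3p2 : (d : ℕ) → 1 ≤ d → (t : ℕ → Pt d)
    → (∀ n → t n <ₗ t (suc n))
    → 𝟘 <ₗ t 0
    → (∀ n → ((+ 2) · t n) ≤ₗ t (suc n))
    → (∃ λ n → AllPos (t n))
    → ((∀ n x → I t n x
          → ¬ (∃ λ m → (n + 2 ≤ m) × (J t m ⊞ W t) x)
            × ¬ ((J t (suc n) ⊞ Wminus t (t n)) x))
      × (∀ n → 1 ≤ n → ∀ x
          → ((λ a → (∃ λ m → (m < n) × J t m a) ⊎ (J t n a × (⊖ ((+ 2) · prev1 t n)) ≤ₗ a)) ⊞ W t) x
          → ¬ ((⊖ t n) ≤ₗ x) ⊎ (⊖ ((+ 3) · prev1 t n)) ≤ₗ x)
      × ((∀ n → 1 ≤ n → ((+ 3) · prev1 t n) <ₗ t n)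
          → ∀ n x → I t n x
          → ¬ (∃ λ m → (suc n ≤ m)
                × ((neg (λ a → J t m a × (⊖ ((+ 2) · prev1 t m)) ≤ₗ a)) ⊞ W t) x))
      × ((∀ n → 1 ≤ n → ((+ 3) · prev1 t n) ≤ₗ t n)
          → ∀ n → 1 ≤ n → ∀ x
          → ((neg (λ a → ∃ λ m → (1 ≤ m) × (m ≤ n) × J t m a)) ⊞ Wminus t (⊖ t n)) x
          → x ≤ₗ (⊖ ((+ 2) · t n)) ⊎ ¬ (x ≤ₗ (⊖ prev1 t n))))
proposition3p2 d _ t t-inc t₀-pos _ _ =
    (λ n x x∈I → (λ (m , n+2≤m , x∈J⊞W) → I⇒∉J⊞W (subst (_≤ m) (+-comm n 2) n+2≤m) x∈I x∈J⊞W)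
               , I⇒∉J⊞W∖t x∈I)
  , J⊞W-bound
  , (λ 3t<t → I⇒∉⊖J⊞W (λ n → 3t<t (suc n) (s≤s z≤n)))
  , (λ 3t≤t → ⊖J⊞W∖⊖t-bound (λ n → 3t≤t (suc n) (s≤s z≤n)))
  where open PositiveIncreasing t t-inc t₀-pos
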